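{- Let $G$ be a connected $d$-regular graph such that (1) $\kappa(G)\geq 4$, or (2) $\kappa(G)=d=3$. Then every path in $G$ of length at most $4$ closes to a cycle.
   Context: All graphs are finite, simple and undirected. A graph is $d$-regular if every vertex has degree $d$. For $k\ge 0$, a graph $G$ is $k$-connected if $|V(G)|\ge k+1$ and $G-S$ is connected for every $S\subseteq V(G)$ with $|S|<k$; $\kappa(G)$ is the largest $k$ such that $G$ is $k$-connected. A path of length $\ell$ is a sequence $(x_0,\dots,x_\ell)$ of pairwise distinct vertices with consecutive vertices adjacent (length $0$ means a single vertex). A cycle is a sequence $(x_0,\dots,x_{\ell-1},x_\ell=x_0)$ with $\ell\ge 3$, $x_0,\dots,x_{\ell-1}$ pairwise distinct and consecutive vertices adjacent. A path $P$ closes to a cycle if some cycle $C$ in $G$ contains $P$ as a subgraph. -}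

module Defs where

open import Data.Nat using (ℕ; zero; suc; _≤_; _<_)
open import Data.Bool using (Bool; true; false)
open import Data.Fin using (Fin)
open import Data.Fin.Subset using (Subset; _∈_; _∉_; ∣_∣; ⊥)
open import Data.List using (List; []; _∷_; _++_; [_]; length; filterᵇ; allFin)
import Data.List.Membership.Propositional as LM
open import Data.List.Relation.Unary.All using (All)
open import Data.List.Relation.Unary.Unique.Propositional using (Unique)
open import Data.List.Relation.Unary.Linked using (Linked)
open import Data.Product using (Σ; _×_; _,_)
open import Data.Sum using (_⊎_)
open import Relation.Binary.PropositionalEquality using (_≡_; _≢_)
open import Relation.Nullary using (¬_)

record Graph : Set where
  field
    n      : ℕ
    adj    : Fin n → Fin n → Bool
    sym    : ∀ u v → adj u v ≡ adj v u
    irrefl : ∀ v → adj v v ≡ false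

open Graph public

Adj : (G : Graph) → Fin (n G) → Fin (n G) → Set
Adj G u v = adj G u v ≡ true

degree : (G : Graph) → Fin (n G) → ℕ
degree G v = length (filterᵇ (adj G v) (allFin (n G)))

Regular : Graph → ℕ → Set
Regular G d = ∀ v → degree G v ≡ d

data WalkAvoiding (G : Graph) (S : Subset (n G)) : Fin (n G) → Fin (n G) → Set where
  here  : ∀ {v} → v ∉ S → WalkAvoiding G S v v
  step  : ∀ {u w v} → u ∉ S → Adj G u w → WalkAvoiding G S w v → WalkAvoiding G S u v

ConnectedMinus : (G : Graph) → Subset (n G) → Set
ConnectedMinus G S = ∀ u v → u ∉ S → v ∉ S → WalkAvoiding G S u v

Connected : Graph → Set
Connected G = ConnectedMinus G ⊥

KConnected : Graph → ℕ → Set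
KConnected G k = (suc k ≤ n G) × (∀ (S : Subset (n G)) → ∣ S ∣ < k → ConnectedMinus G S)

-- κ(G) = k : k is the largest integer such that G is k-connected
-- (k-connectedness is downward closed, so this is "k-connected but not (k+1)-connected")
IsKappa : Graph → ℕ → Set
IsKappa G k = KConnected G k × (∀ j → KConnected G j → j ≤ k)

-- paths: nonempty lists of pairwise distinct vertices, consecutive ones adjacent;
-- length of the path = number of vertices - 1
IsPath : (G : Graph) → List (Fin (n G)) → Set
IsPath G xs = (xs ≢ []) × Unique xs × Linked (Adj G) xs

data Consec {A : Set} : List A → A → A → Set where
  here  : ∀ {x y rest} → Consec (x ∷ y ∷ rest) x y
  there : ∀ {z xs x y} → Consec xs x y → Consec (z ∷ xs) x y

-- a cycle (c0, c1, ..., c_{l-1}, c0) given by c0 and the list [c1..c_{l-1}]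
IsCycle : (G : Graph) → Fin (n G) → List (Fin (n G)) → Set
IsCycle G c0 rest =
  (2 ≤ length rest) × Unique (c0 ∷ rest) × Linked (Adj G) (c0 ∷ rest ++ [ c0 ])

CycleEdge : {A : Set} → A → List A → A → A → Set
CycleEdge c0 rest u v = Consec (c0 ∷ rest ++ [ c0 ]) u v ⊎ Consec (c0 ∷ rest ++ [ c0 ]) v u

PathInCycle : {A : Set} → List A → A → List A → Set
PathInCycle xs c0 rest =
  All (λ x → x LM.∈ (c0 ∷ rest)) xs × (∀ u v → Consec xs u v → CycleEdge c0 rest u v)

Fin′ : Graph → Set
Fin′ G = Fin (n G)

ClosesToCycle : (G : Graph) → List (Fin (n G)) → Set
ClosesToCycle G xs = Σ (Fin (n G)) λ c0 → Σ (List (Fin (n G))) λ rest →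
  IsCycle G c0 rest × PathInCycle xs c0 rest

-- Let P = (x₀, M, xₗ) be a path with nonempty interior M. If G − M is connected,
-- any xₗ–x₀ path in G − M together with P is a cycle through P. When κ ≥ 4
-- every path of length ≤ 4 has at most three interior vertices, so this applies
-- directly; when κ = 3 it covers paths of length 2 and 3, and paths of length 0 and 1
-- are first extended to length 2. For a path (a, b, c, d, e) in a cubic graph remove
-- only {b, d}: a return path in G − {b, d} avoids c as well, since passing through c
-- would give c two neighbours besides b and d.
module Submission where

open import Defs
open import Data.Bool using (T?)
open import Data.Bool.Properties using (T-≡)
open import Data.Empty using (⊥-elim)
open import Data.Fin using (Fin; _≟_)
open import Data.Fin.Properties using (¬∀⟶∃¬)
open import Data.Fin.Subset using (Subset; ⁅_⁆; _∪_; ∣_∣; inside; outside)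
  renaming (_∈_ to _∈ₛ_; _∉_ to _∉ₛ_; ⊥ to ∅)
open import Data.Fin.Subset.Properties using (∉⊥; x∈⁅x⁆; x∈⁅y⁆⇒x≡y; x∈p∪q⁻; x∈p∪q⁺; ∣⁅x⁆∣≡1; ∣⊥∣≡0)
open import Data.List using (List; []; _∷_; _++_; [_]; length)
open import Data.List.Properties using (++-assoc; length-removeAt′; length-tabulate)
open import Data.List.Membership.Propositional using (_∈_; _∉_)
open import Data.List.Membership.Propositional.Properties using (∈-++⁺ˡ; ∈-++⁺ʳ; ∈-++⁻; ∈-filter⁺; ∈-allFin)
open import Data.List.Relation.Binary.Subset.Propositional using (_⊆_)
open import Data.List.Relation.Unary.Any using (here; there; any?; _─_)
open import Data.List.Relation.Unary.All as All using (All; []; _∷_)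
open import Data.List.Relation.Unary.All.Properties using (¬Any⇒All¬) renaming (++⁺ to All-++⁺; ++⁻ˡ to All-++⁻ˡ)
open import Data.List.Relation.Unary.Linked using (Linked; []; [-]; _∷_)
open import Data.List.Relation.Unary.Unique.Propositional using (Unique; []; _∷_)
open import Data.List.Relation.Unary.Unique.Propositional.Properties
  using (allFin⁺; Unique[x∷xs]⇒x∉xs) renaming (++⁺ to Unique-++⁺)
open import Data.Nat using (ℕ; suc; _+_; _≤_; _<_; z≤n; s≤s)
open import Data.Nat.Properties using (≤-refl; ≤-trans; <-≤-trans; ≤-<-trans; <⇒≱; <-irrefl; n≤1+n; +-suc; +-monoʳ-≤; ≤-reflexive)
open import Data.Product using (Σ; ∃; ∃₂; _×_; _,_)
open import Data.Sum using (_⊎_; inj₁; inj₂)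
open import Data.Vec using ([]; _∷_)
open import Relation.Binary.PropositionalEquality using (_≡_; _≢_; refl; trans; cong; subst) renaming (sym to ≡-sym)
open import Function using (_∘_)
open import Function.Bundles using (Equivalence)
open import Relation.Nullary using (¬_; yes; no)

module _ {A : Set} where

  Linked-∷ʳ-++ : ∀ {_~_ : A → A → Set} xs {x ys} →
    Linked _~_ (xs ++ [ x ]) → Linked _~_ (x ∷ ys) → Linked _~_ ((xs ++ [ x ]) ++ ys)
  Linked-∷ʳ-++ []           _          l = l
  Linked-∷ʳ-++ (_ ∷ [])     (r ∷ [-])  l = r ∷ l
  Linked-∷ʳ-++ (_ ∷ y ∷ xs) (r ∷ l₁)   l = r ∷ Linked-∷ʳ-++ (y ∷ xs) l₁ l

  Unique-∷ʳ⁻ : ∀ xs {x : A} → Unique (xs ++ [ x ]) → Unique xs × x ∉ xs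
  Unique-∷ʳ⁻ []       _           = [] , λ ()
  Unique-∷ʳ⁻ (y ∷ xs) (y∉ ∷ uxs) with Unique-∷ʳ⁻ xs uxs
  ... | uxs′ , x∉xs = All-++⁻ˡ xs y∉ ∷ uxs′ , λ
    { (here x≡y) → All.lookup y∉ (∈-++⁺ʳ xs (here refl)) (≡-sym x≡y)
    ; (there x∈) → x∉xs x∈ }

  Consec-++ : ∀ {xs ys : List A} {u v} → Consec xs u v → Consec (xs ++ ys) u v
  Consec-++ here      = here
  Consec-++ (there c) = there (Consec-++ c)

  ∈-─ : ∀ {x z : A} {ys} → z ∈ ys → (x∈ys : x ∈ ys) → z ≢ x → z ∈ (ys ─ x∈ys)
  ∈-─ (here refl) (here refl) z≢x = ⊥-elim (z≢x refl)
  ∈-─ (there z∈)  (here refl) _   = z∈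
  ∈-─ (here refl) (there _)   _   = here refl
  ∈-─ (there z∈)  (there x∈)  z≢x = there (∈-─ z∈ x∈ z≢x)

  Unique-⊆⇒length≤ : ∀ {xs ys : List A} → Unique xs → xs ⊆ ys → length xs ≤ length ys
  Unique-⊆⇒length≤ {[]}     _          _   = z≤n
  Unique-⊆⇒length≤ {x ∷ xs} {ys} (x∉ ∷ uxs) xs⊆ys =
    ≤-trans (s≤s (Unique-⊆⇒length≤ uxs xs⊆ys─x)) (≤-reflexive (≡-sym (length-removeAt′ ys _)))
    where
    x∈ys = xs⊆ys (here refl)
    xs⊆ys─x : xs ⊆ (ys ─ x∈ys)
    xs⊆ys─x z∈ = ∈-─ (xs⊆ys (there z∈)) x∈ys (λ z≡x → All.lookup x∉ z∈ (≡-sym z≡x))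

fresh : ∀ {m} (xs : List (Fin m)) → length xs < m → ∃ λ z → z ∉ xs
fresh {m} xs |xs|<m = ¬∀⟶∃¬ m (_∈ xs) (λ z → any? (z ≟_) xs) λ all∈xs →
  <⇒≱ |xs|<m (subst (_≤ length xs) (length-tabulate {n = m} (λ i → i))
    (Unique-⊆⇒length≤ (allFin⁺ m) (λ {z} _ → all∈xs z)))

∣p∪q∣≤∣p∣+∣q∣ : ∀ {m} (p q : Subset m) → ∣ p ∪ q ∣ ≤ ∣ p ∣ + ∣ q ∣
∣p∪q∣≤∣p∣+∣q∣ []             []             = z≤n
∣p∪q∣≤∣p∣+∣q∣ (inside ∷ p)  (inside ∷ q)  = s≤s (≤-trans (∣p∪q∣≤∣p∣+∣q∣ p q) (+-monoʳ-≤ ∣ p ∣ (n≤1+n _)))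
∣p∪q∣≤∣p∣+∣q∣ (inside ∷ p)  (outside ∷ q) = s≤s (∣p∪q∣≤∣p∣+∣q∣ p q)
∣p∪q∣≤∣p∣+∣q∣ (outside ∷ p) (inside ∷ q)  =
  ≤-trans (s≤s (∣p∪q∣≤∣p∣+∣q∣ p q)) (≤-reflexive (≡-sym (+-suc ∣ p ∣ ∣ q ∣)))
∣p∪q∣≤∣p∣+∣q∣ (outside ∷ p) (outside ∷ q) = ∣p∪q∣≤∣p∣+∣q∣ p q

fromList : ∀ {m} → List (Fin m) → Subset m
fromList []       = ∅
fromList (x ∷ xs) = ⁅ x ⁆ ∪ fromList xs

∣fromList∣≤length : ∀ {m} (xs : List (Fin m)) → ∣ fromList xs ∣ ≤ length xs
∣fromList∣≤length {m} []  = ≤-reflexive (∣⊥∣≡0 m)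
∣fromList∣≤length (x ∷ xs) = ≤-trans (∣p∪q∣≤∣p∣+∣q∣ ⁅ x ⁆ (fromList xs))
  (subst (λ k → k + ∣ fromList xs ∣ ≤ suc (length xs)) (≡-sym (∣⁅x⁆∣≡1 x)) (s≤s (∣fromList∣≤length xs)))

∈⇒∈fromList : ∀ {m} {x : Fin m} {xs} → x ∈ xs → x ∈ₛ fromList xs
∈⇒∈fromList {xs = y ∷ _} (here refl) = x∈p∪q⁺ (inj₁ (x∈⁅x⁆ y))
∈⇒∈fromList (there x∈)               = x∈p∪q⁺ (inj₂ (∈⇒∈fromList x∈))

∉⇒∉fromList : ∀ {m} {x : Fin m} xs → x ∉ xs → x ∉ₛ fromList xs
∉⇒∉fromList []       _  = ∉⊥
∉⇒∉fromList (y ∷ xs) x∉ x∈ with x∈p∪q⁻ ⁅ y ⁆ (fromList xs) x∈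
... | inj₁ x∈⁅y⁆ = x∉ (here (x∈⁅y⁆⇒x≡y y x∈⁅y⁆))
... | inj₂ x∈ys  = ∉⇒∉fromList xs (λ x∈xs → x∉ (there x∈xs)) x∈ys

KConnected-weaken : ∀ {G j k} → j ≤ k → KConnected G k → KConnected G j
KConnected-weaken j≤k (k<n , separate) =
  ≤-trans (s≤s j≤k) k<n , λ S |S|<j → separate S (<-≤-trans |S|<j j≤k)

module _ (G : Graph) where

  private
    V = Fin (n G)

  Adj-sym : ∀ {u v} → Adj G u v → Adj G v u
  Adj-sym {u} {v} uv = trans (Graph.sym G v u) uv

  Adj⇒≢ : ∀ {u v} → Adj G u v → u ≢ v
  Adj⇒≢ {u} uv refl with trans (≡-sym uv) (irrefl G u)
  ... | ()

  Unique-neighbours⇒length≤degree : ∀ {v} {N : List V} → Unique N → All (Adj G v) N →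
    length N ≤ degree G v
  Unique-neighbours⇒length≤degree {v} uN adjN =
    Unique-⊆⇒length≤ uN λ {z} z∈N →
      ∈-filter⁺ (T? ∘ adj G v) (∈-allFin z) (Equivalence.from T-≡ (All.lookup adjN z∈N))

  record PathAvoiding (S : Subset (n G)) (u v : V) : Set where
    constructor path
    field
      interior : List V
      linked   : Linked (Adj G) (u ∷ interior ++ [ v ])
      unique   : Unique (u ∷ interior ++ [ v ])
      avoids   : All (_∉ₛ S) (u ∷ interior ++ [ v ])

  open PathAvoiding

  interior-avoids : ∀ {S u v} (p : PathAvoiding S u v) → All (_∉ₛ S) (interior p)
  interior-avoids (path R _ _ (_ ∷ av)) = All-++⁻ˡ R av

  walk-start∉ : ∀ {S u v} → WalkAvoiding G S u v → u ∉ₛ S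
  walk-start∉ (here u∉S)     = u∉S
  walk-start∉ (step u∉S _ _) = u∉S

  walk-neighbour : ∀ {S u v} → WalkAvoiding G S u v → u ≢ v → ∃ λ w → Adj G u w × w ∉ₛ S
  walk-neighbour (here _)         u≢u = ⊥-elim (u≢u refl)
  walk-neighbour (step _ uw rest) _   = _ , uw , walk-start∉ rest

  PathAvoiding-suffix : ∀ {S w u v} R → Linked (Adj G) (w ∷ R ++ [ v ]) → Unique (w ∷ R ++ [ v ]) →
    All (_∉ₛ S) (w ∷ R ++ [ v ]) → u ∈ R → PathAvoiding S u v
  PathAvoiding-suffix (_ ∷ R) (_ ∷ l) (_ ∷ un) (_ ∷ av) (here refl) = path R l un av
  PathAvoiding-suffix (_ ∷ R) (_ ∷ l) (_ ∷ un) (_ ∷ av) (there u∈) = PathAvoiding-suffix R l un av u∈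

  walk⇒path : ∀ {S u v} → WalkAvoiding G S u v → u ≢ v → PathAvoiding S u v
  walk⇒path (here _) u≢u = ⊥-elim (u≢u refl)
  walk⇒path (step {w = w} {v} u∉S uw rest) u≢v with w ≟ v
  ... | yes refl = path [] (uw ∷ [-]) ((Adj⇒≢ uw ∷ []) ∷ [] ∷ []) (u∉S ∷ walk-start∉ rest ∷ [])
  ... | no w≢v with walk⇒path rest w≢v
  ...   | path R l un av with any? (_ ≟_) R
  ...     | yes u∈R = PathAvoiding-suffix R l un av u∈R
  ...     | no u∉R  = path (w ∷ R) (uw ∷ l) (u-new ∷ un) (u∉S ∷ av)
    where
    u-new = Adj⇒≢ uw ∷ All-++⁺ (¬Any⇒All¬ R u∉R) (u≢v ∷ [])

  inner-neighbours : ∀ {P : V → Set} {h t x} R → x ∈ R →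
    Linked (Adj G) (h ∷ R ++ [ t ]) → Unique (h ∷ R ++ [ t ]) → All P (h ∷ R ++ [ t ]) →
    ∃₂ λ y z → Adj G y x × Adj G x z × y ≢ z × P y × P z
  inner-neighbours (_ ∷ []) (here refl) (hx ∷ xt ∷ [-]) ((_ ∷ h≢t ∷ []) ∷ _) (Ph ∷ _ ∷ Pt ∷ []) =
    _ , _ , hx , xt , h≢t , Ph , Pt
  inner-neighbours (_ ∷ _ ∷ _) (here refl) (hx ∷ xz ∷ _) ((_ ∷ h≢z ∷ _) ∷ _) (Ph ∷ _ ∷ Pz ∷ _) =
    _ , _ , hx , xz , h≢z , Ph , Pz
  inner-neighbours (_ ∷ R) (there x∈) (_ ∷ l) (_ ∷ un) (_ ∷ Ps) = inner-neighbours R x∈ l un Ps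

  inner-vertex-degree : ∀ {S u v x} (p : PathAvoiding S u v) → x ∈ interior p →
    (N : List V) → Unique N → All (Adj G x) N → All (_∈ₛ S) N → 2 + length N ≤ degree G x
  inner-vertex-degree {S} (path R l un av) x∈R N uN adjN N⊆S
    with y , z , yx , xz , y≢z , y∉S , z∉S ← inner-neighbours R x∈R l un av =
    Unique-neighbours⇒length≤degree
      ((y≢z ∷ All.map (outside≢inside y∉S) N⊆S) ∷ All.map (outside≢inside z∉S) N⊆S ∷ uN)
      (Adj-sym yx ∷ xz ∷ adjN)
    where
    outside≢inside : ∀ {a b} → a ∉ₛ S → b ∈ₛ S → a ≢ b
    outside≢inside a∉S b∈S refl = a∉S b∈S

  -- The cycle is x₀, M, xₗ, R, x₀; its list is taken as (x₀ ∷ M ++ [ xₗ ]) ++ R so that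
  -- uniqueness and the path's edges are read off without reassociating.
  closes-via-return-path : ∀ {x₀ xₗ m M} R →
    Linked (Adj G) (x₀ ∷ m ∷ M ++ [ xₗ ]) → Unique (x₀ ∷ m ∷ M ++ [ xₗ ]) →
    Linked (Adj G) (xₗ ∷ R ++ [ x₀ ]) → Unique (xₗ ∷ R ++ [ x₀ ]) →
    All (_∉ m ∷ M) R → ClosesToCycle G (x₀ ∷ m ∷ M ++ [ xₗ ])
  closes-via-return-path {x₀} {xₗ} {m} {M} R lP uP lQ (xₗ∉ ∷ uQ) R∩M≡∅ =
    x₀ , (m ∷ M ++ [ xₗ ]) ++ R , (length≥2 M , cycle-unique , cycle-linked) ,
    All.tabulate ∈-++⁺ˡ , λ _ _ uv → inj₁ (Consec-++ (Consec-++ uv))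
    where
    P = x₀ ∷ m ∷ M ++ [ xₗ ]
    length≥2 : ∀ K → 2 ≤ length ((m ∷ K ++ [ xₗ ]) ++ R)
    length≥2 []      = s≤s (s≤s z≤n)
    length≥2 (_ ∷ _) = s≤s (s≤s z≤n)
    cycle-linked : Linked (Adj G) ((P ++ R) ++ [ x₀ ])
    cycle-linked = subst (Linked (Adj G)) (≡-sym (++-assoc P R [ x₀ ])) (Linked-∷ʳ-++ (x₀ ∷ m ∷ M) lP lQ)
    xₗ∉R : xₗ ∉ R
    xₗ∉R xₗ∈R = All.lookup (All-++⁻ˡ R xₗ∉) xₗ∈R refl
    cycle-unique : Unique (P ++ R)
    cycle-unique with uR , x₀∉R ← Unique-∷ʳ⁻ R uQ = Unique-++⁺ uP uR λ
      { (here refl , v∈R) → x₀∉R v∈R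
      ; (there v∈ , v∈R) → case-M∪xₗ (∈-++⁻ (m ∷ M) v∈) v∈R }
      where
      case-M∪xₗ : ∀ {v} → v ∈ m ∷ M ⊎ v ∈ [ xₗ ] → ¬ v ∈ R
      case-M∪xₗ (inj₁ v∈M)         v∈R = All.lookup R∩M≡∅ v∈R v∈M
      case-M∪xₗ (inj₂ (here refl)) v∈R = xₗ∉R v∈R

  closes-if-interior-separates : ∀ {x₀ xₗ m M} → ConnectedMinus G (fromList (m ∷ M)) →
    Linked (Adj G) (x₀ ∷ m ∷ M ++ [ xₗ ]) → Unique (x₀ ∷ m ∷ M ++ [ xₗ ]) →
    ClosesToCycle G (x₀ ∷ m ∷ M ++ [ xₗ ])
  closes-if-interior-separates {x₀} {xₗ} {m} {M} connected lP uP
    with uP′ , xₗ∉P ← Unique-∷ʳ⁻ (x₀ ∷ m ∷ M) uP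
    with Q ← walk⇒path (connected xₗ x₀ (∉⇒∉fromList (m ∷ M) (xₗ∉P ∘ there))
                                        (∉⇒∉fromList (m ∷ M) (Unique[x∷xs]⇒x∉xs uP′)))
                       (xₗ∉P ∘ here)
    = closes-via-return-path (interior Q) lP uP (linked Q) (unique Q)
        (All.map (λ r∉S r∈M → r∉S (∈⇒∈fromList r∈M)) (interior-avoids Q))

  closes-if-interior-small : ∀ {k x₀ xₗ m M} → KConnected G k → length (m ∷ M) < k →
    Linked (Adj G) (x₀ ∷ m ∷ M ++ [ xₗ ]) → Unique (x₀ ∷ m ∷ M ++ [ xₗ ]) →
    ClosesToCycle G (x₀ ∷ m ∷ M ++ [ xₗ ])
  closes-if-interior-small {m = m} {M} (_ , separate) |M|<k =
    closes-if-interior-separates (separate _ (≤-<-trans (∣fromList∣≤length (m ∷ M)) |M|<k))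

  ClosesToCycle-tail : ∀ {x xs} → ClosesToCycle G (x ∷ xs) → ClosesToCycle G xs
  ClosesToCycle-tail (c₀ , rest , cycle , _ ∷ xs⊆C , edges) =
    c₀ , rest , cycle , xs⊆C , λ u v uv → edges u v (there uv)

  neighbour-besides : KConnected G 2 → ∀ {a b} → a ≢ b → ∃ λ w → Adj G a w × w ≢ b
  neighbour-besides (3≤n , separate) {a} {b} a≢b = besides (fresh (a ∷ b ∷ []) 3≤n)
    where
    ∉⁅b⁆ : ∀ {x} → x ≢ b → x ∉ₛ ⁅ b ⁆
    ∉⁅b⁆ x≢b x∈⁅b⁆ = x≢b (x∈⁅y⁆⇒x≡y b x∈⁅b⁆)
    besides : ∃ (λ z → z ∉ a ∷ b ∷ []) → ∃ λ w → Adj G a w × w ≢ b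
    besides (z , z∉ab) with w , aw , w∉⁅b⁆ ← walk-neighbour
        (separate ⁅ b ⁆ (≤-reflexive (cong suc (∣⁅x⁆∣≡1 b))) a z (∉⁅b⁆ a≢b) (∉⁅b⁆ (λ z≡b → z∉ab (there (here z≡b)))))
        (λ a≡z → z∉ab (here (≡-sym a≡z)))
      = w , aw , λ w≡b → w∉⁅b⁆ (subst (_∈ₛ ⁅ b ⁆) (≡-sym w≡b) (x∈⁅x⁆ b))

  edge-closes : ∀ {a b} → KConnected G 2 → Adj G a b → ClosesToCycle G (a ∷ b ∷ [])
  edge-closes 2-conn ab with w , aw , w≢b ← neighbour-besides 2-conn (Adj⇒≢ ab) =
    ClosesToCycle-tail (closes-if-interior-small {M = []} 2-conn ≤-refl (Adj-sym aw ∷ ab ∷ [-])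
      ((Adj⇒≢ (Adj-sym aw) ∷ w≢b ∷ []) ∷ (Adj⇒≢ ab ∷ []) ∷ [] ∷ []))

  vertex-closes : KConnected G 2 → ∀ a → ClosesToCycle G [ a ]
  vertex-closes 2-conn@(3≤n , _) a
    with z , z∉a ← fresh [ a ] (≤-trans (n≤1+n 2) 3≤n)
    with w , aw , _ ← neighbour-besides 2-conn (λ a≡z → z∉a (here (≡-sym a≡z)))
    = ClosesToCycle-tail (edge-closes 2-conn (Adj-sym aw))

  cubic-path-closes : ∀ {a b c d e} → KConnected G 3 → Regular G 3 →
    Linked (Adj G) (a ∷ b ∷ c ∷ d ∷ e ∷ []) → Unique (a ∷ b ∷ c ∷ d ∷ e ∷ []) →
    ClosesToCycle G (a ∷ b ∷ c ∷ d ∷ e ∷ [])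
  cubic-path-closes {a} {b} {c} {d} {e} (_ , separate) cubic l@(_ ∷ bc ∷ cd ∷ _)
    u@((a≢b ∷ _ ∷ a≢d ∷ a≢e ∷ []) ∷ (_ ∷ b≢d ∷ b≢e ∷ []) ∷ _ ∷ (d≢e ∷ []) ∷ [] ∷ []) =
    closes-with (walk⇒path (separate S (s≤s (∣fromList∣≤length (b ∷ d ∷ []))) e a e∉S a∉S)
                           (λ e≡a → a≢e (≡-sym e≡a)))
    where
    S = fromList (b ∷ d ∷ [])
    a∉S = ∉⇒∉fromList (b ∷ d ∷ []) λ { (here a≡b) → a≢b a≡b ; (there (here a≡d)) → a≢d a≡d }
    e∉S = ∉⇒∉fromList (b ∷ d ∷ []) λ { (here e≡b) → b≢e (≡-sym e≡b) ; (there (here e≡d)) → d≢e (≡-sym e≡d) }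
    b∈S = ∈⇒∈fromList {xs = b ∷ d ∷ []} (here refl)
    d∈S = ∈⇒∈fromList {xs = b ∷ d ∷ []} (there (here refl))
    closes-with : PathAvoiding S e a → ClosesToCycle G (a ∷ b ∷ c ∷ d ∷ e ∷ [])
    closes-with Q with any? (c ≟_) (interior Q)
    ... | yes c∈R = ⊥-elim (<-irrefl refl (subst (4 ≤_) (cubic c)
          (inner-vertex-degree Q c∈R (b ∷ d ∷ []) ((b≢d ∷ []) ∷ [] ∷ []) (Adj-sym bc ∷ cd ∷ []) (b∈S ∷ d∈S ∷ []))))
    ... | no c∉R = closes-via-return-path (interior Q) l u (linked Q) (unique Q) (All.tabulate R∩bcd≡∅)
      where
      R∩bcd≡∅ : ∀ {r} → r ∈ interior Q → r ∉ b ∷ c ∷ d ∷ []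
      R∩bcd≡∅ r∈R (here refl)                 = All.lookup (interior-avoids Q) r∈R b∈S
      R∩bcd≡∅ r∈R (there (here refl))         = c∉R r∈R
      R∩bcd≡∅ r∈R (there (there (here refl))) = All.lookup (interior-avoids Q) r∈R d∈S

κ≥3⇒3-connected : ∀ G {d} → (Σ ℕ λ k → IsKappa G k × 4 ≤ k) ⊎ (IsKappa G 3 × d ≡ 3) → KConnected G 3
κ≥3⇒3-connected G (inj₁ (k , (k-connected , _) , 4≤k)) = KConnected-weaken {G} (≤-trans (n≤1+n 3) 4≤k) k-connected
κ≥3⇒3-connected G (inj₂ ((3-connected , _) , _))       = 3-connected

proposition3p1 : (G : Graph) (d : ℕ) → Connected G → Regular G d →
    ((Σ ℕ λ k → IsKappa G k × 4 ≤ k) ⊎ (IsKappa G 3 × d ≡ 3)) →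
    (xs : List (Fin′ G)) → IsPath G xs → length xs ≤ 5 → ClosesToCycle G xs
proposition3p1 G _ _ _ κ [] ([]≢[] , _) _ = ⊥-elim ([]≢[] refl)
proposition3p1 G _ _ _ κ (a ∷ []) _ _ =
  vertex-closes G (KConnected-weaken {G} (n≤1+n 2) (κ≥3⇒3-connected G κ)) a
proposition3p1 G _ _ _ κ (_ ∷ _ ∷ []) (_ , _ , ab ∷ _) _ =
  edge-closes G (KConnected-weaken {G} (n≤1+n 2) (κ≥3⇒3-connected G κ)) ab
proposition3p1 G _ _ _ κ (_ ∷ _ ∷ _ ∷ []) (_ , u , l) _ =
  closes-if-interior-small G {M = []} (κ≥3⇒3-connected G κ) (n≤1+n 2) l u
proposition3p1 G _ _ _ κ (_ ∷ _ ∷ _ ∷ _ ∷ []) (_ , u , l) _ =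
  closes-if-interior-small G {M = _ ∷ []} (κ≥3⇒3-connected G κ) ≤-refl l u
proposition3p1 G _ _ _ (inj₁ (k , (k-connected , _) , 4≤k)) (_ ∷ _ ∷ _ ∷ _ ∷ _ ∷ []) (_ , u , l) _ =
  closes-if-interior-small G {M = _ ∷ _ ∷ []} (KConnected-weaken {G} 4≤k k-connected) ≤-refl l u
proposition3p1 G _ _ cubic κ@(inj₂ (_ , refl)) (_ ∷ _ ∷ _ ∷ _ ∷ _ ∷ []) (_ , u , l) _ =
  cubic-path-closes G (κ≥3⇒3-connected G κ) cubic l u
proposition3p1 G _ _ _ _ (_ ∷ _ ∷ _ ∷ _ ∷ _ ∷ _ ∷ _) _ (s≤s (s≤s (s≤s (s≤s (s≤s ())))))
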